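{- For every typing context $\Gamma$ of $\Lambda_\cap^s$, $\lambda$-term $M$ and type $A$: $\Gamma\vdash_s M:A$ is derivable in $\Lambda_\cap^s$ if and only if $\Gamma_\cap\vdash M:A$ is derivable in $\Lambda_\cap$.
   Context: $\lambda$-terms: $M::=x\mid MM\mid\lambda x.M$ modulo $\alpha$-conversion; $M[x:=N]$ capture-avoiding substitution. Types: $A::=\varphi\mid A\to A\mid A\cap A$. A typing context is a finite set of pairs $x:A$ ($\Gamma,x:A$ denotes $\Gamma\cup\{x:A\}$; $x\notin\Gamma$ means no $x:B$ lies in $\Gamma$); in $\Lambda_\cap$ its variables are pairwise distinct, in $\Lambda_\cap^s$ a variable may occur with several types. For a context $\Gamma$ of $\Lambda_\cap^s$, $\Gamma_\cap$ is the context in which each variable of $\Gamma$ is assigned the intersection of all the types it has in $\Gamma$. $\Lambda_\cap$: (Ax) $\Gamma,x:A\vdash x:A$; ($\to$I) from $\Gamma,x:A\vdash M:B$, $x\notin\Gamma$, infer $\Gamma\vdash\lambda x.M:A\to B$; ($\to$E) from $\Gamma\vdash M:A\to B$ and $\Gamma\vdash N:A$ infer $\Gamma\vdash MN:B$; ($\cap$I) from $\Gamma\vdash M:A$, $\Gamma\vdash M:B$ infer $\Gamma\vdash M:A\cap B$; ($\cap$E) from $\Gamma\vdash M:A\cap B$ infer $\Gamma\vdash M:A$ and $\Gamma\vdash M:B$. $\Lambda_\cap^s$ ($n\ge0$): (Ax) $\Gamma,x:A\vdash_s x:A$; $(\mathsf{Beta})^s$ from $\Gamma\vdash_s M[x:=N]N_1\dots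 N_n:A$ and $\Gamma\vdash_s N:B$ infer $\Gamma\vdash_s(\lambda x.M)NN_1\dots N_n:A$; $(\mathsf{L}\to)$ from $\Gamma\vdash_s N:A_1$ and $\Gamma,y:A_2\vdash_s yN_1\dots N_n:B$, with $y\notin FV(N_1)\cup\dots\cup FV(N_n)$, $y\notin\Gamma$, infer $\Gamma,x:A_1\to A_2\vdash_s xNN_1\dots N_n:B$; $(\mathsf{R}\to)$ from $\Gamma,x:A\vdash_s M:B$, $x\notin\Gamma$, infer $\Gamma\vdash_s\lambda x.M:A\to B$; $(\mathsf{L}\cap)$ from $\Gamma,x:A_1,x:A_2\vdash_s xN_1\dots N_n:B$ infer $\Gamma,x:A_1\cap A_2\vdash_s xN_1\dots N_n:B$; $(\mathsf{R}\cap)$ from $\Gamma\vdash_s M:A$ and $\Gamma\vdash_s M:B$ infer $\Gamma\vdash_s M:A\cap B$. -}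

module Defs where

open import Data.Nat using (ℕ; zero; suc; _≟_)
open import Data.Product using (_×_; _,_; proj₁; proj₂; Σ)
open import Data.Product.Properties using (≡-dec)
open import Data.List using (List; []; _∷_; map; foldl; foldr; deduplicate)
open import Data.List.Membership.Propositional using (_∈_; _∉_)
open import Data.List.Relation.Binary.Subset.Propositional using (_⊆_)
open import Data.List.Relation.Unary.All using (All)
open import Relation.Binary.PropositionalEquality using (_≡_; refl; cong; cong₂)
open import Relation.Binary.Definitions using (DecidableEquality)
open import Relation.Nullary using (¬_; yes; no)

-- λ-terms modulo α-conversion: de Bruijn indices.
-- Free variables are the natural-number indices; binders shift them.

infixl 7 _·_
data Term : Set where
  var : ℕ → Term
  _·_ : Term → Term → Term
  ƛ_  : Term → Term

_·*_ : Term → List Term → Term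
M ·* Ns = foldl _·_ M Ns

ext : (ℕ → ℕ) → ℕ → ℕ
ext ρ zero = zero
ext ρ (suc n) = suc (ρ n)

rename : (ℕ → ℕ) → Term → Term
rename ρ (var x) = var (ρ x)
rename ρ (M · N) = rename ρ M · rename ρ N
rename ρ (ƛ M) = ƛ rename (ext ρ) M

exts : (ℕ → Term) → ℕ → Term
exts σ zero = var zero
exts σ (suc n) = rename suc (σ n)

subst : (ℕ → Term) → Term → Term
subst σ (var x) = σ x
subst σ (M · N) = subst σ M · subst σ N
subst σ (ƛ M) = ƛ subst (exts σ) M

subst-zero : Term → ℕ → Term
subst-zero N zero = N
subst-zero N (suc n) = var n

-- (λx.M) N  ↦  M[x:=N]  where M is the body of the abstraction
_[_] : Term → Term → Term
M [ N ] = subst (subst-zero N) M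

data _∈FV_ : ℕ → Term → Set where
  fv-var : ∀ {x} → x ∈FV var x
  fv-l   : ∀ {x M N} → x ∈FV M → x ∈FV (M · N)
  fv-r   : ∀ {x M N} → x ∈FV N → x ∈FV (M · N)
  fv-ƛ   : ∀ {x M} → suc x ∈FV M → x ∈FV (ƛ M)

infixr 5 _⇒_
infixr 6 _∩_
data Type : Set where
  atom : ℕ → Type
  _⇒_  : Type → Type → Type
  _∩_  : Type → Type → Type

_≟T_ : DecidableEquality Type
atom a ≟T atom b with a ≟ b
... | yes refl = yes refl
... | no ne = no λ { refl → ne refl }
atom _ ≟T (_ ⇒ _) = no λ ()
atom _ ≟T (_ ∩ _) = no λ ()
(_ ⇒ _) ≟T atom _ = no λ ()
(A ⇒ B) ≟T (C ⇒ D) with A ≟T C | B ≟T D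
... | yes refl | yes refl = yes refl
... | no ne | _ = no λ { refl → ne refl }
... | yes _ | no ne = no λ { refl → ne refl }
(_ ⇒ _) ≟T (_ ∩ _) = no λ ()
(_ ∩ _) ≟T atom _ = no λ ()
(_ ∩ _) ≟T (_ ⇒ _) = no λ ()
(A ∩ B) ≟T (C ∩ D) with A ≟T C | B ≟T D
... | yes refl | yes refl = yes refl
... | no ne | _ = no λ { refl → ne refl }
... | yes _ | no ne = no λ { refl → ne refl }

-- Typing contexts: finite sets of pairs x : A, represented by lists
-- (only membership matters; see _≋_).

Ctx : Set
Ctx = List (ℕ × Type)

_≋_ : Ctx → Ctx → Set
Γ ≋ Δ = (Γ ⊆ Δ) × (Δ ⊆ Γ)

_∉dom_ : ℕ → Ctx → Set
x ∉dom Γ = ∀ B → (x , B) ∉ Γ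

shiftCtx : Ctx → Ctx
shiftCtx = map (λ p → suc (proj₁ p) , proj₂ p)

-- Γ_∩ : each variable gets the intersection of all (distinct) types it
-- has in Γ (in order of first occurrence).

_≟p_ : DecidableEquality (ℕ × Type)
_≟p_ = ≡-dec _≟_ _≟T_

insertCap : ℕ × Type → Ctx → Ctx
insertCap (x , A) [] = (x , A) ∷ []
insertCap (x , A) ((y , C) ∷ Δ) with x ≟ y
... | yes _ = (y , A ∩ C) ∷ Δ
... | no _  = (y , C) ∷ insertCap (x , A) Δ

capCtx : Ctx → Ctx
capCtx Γ = foldr insertCap [] (deduplicate _≟p_ Γ)

infix 4 _⊢_∶_
data _⊢_∶_ : Ctx → Term → Type → Set where
  Ax  : ∀ {Γ x A} → (x , A) ∈ Γ → Γ ⊢ var x ∶ A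
  →I  : ∀ {Γ M A B} → ((0 , A) ∷ shiftCtx Γ) ⊢ M ∶ B → Γ ⊢ ƛ M ∶ A ⇒ B
  →E  : ∀ {Γ M N A B} → Γ ⊢ M ∶ A ⇒ B → Γ ⊢ N ∶ A → Γ ⊢ M · N ∶ B
  ∩I  : ∀ {Γ M A B} → Γ ⊢ M ∶ A → Γ ⊢ M ∶ B → Γ ⊢ M ∶ A ∩ B
  ∩E₁ : ∀ {Γ M A B} → Γ ⊢ M ∶ A ∩ B → Γ ⊢ M ∶ A
  ∩E₂ : ∀ {Γ M A B} → Γ ⊢ M ∶ A ∩ B → Γ ⊢ M ∶ B

-- Λ∩ˢ (sequent style). Conclusions of left rules are stated for any
-- context Δ equal as a set to Γ ∪ {x : C}.

infix 4 _⊢s_∶_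
data _⊢s_∶_ : Ctx → Term → Type → Set where
  Ax   : ∀ {Γ x A} → (x , A) ∈ Γ → Γ ⊢s var x ∶ A
  Beta : ∀ {Γ M N Ns A B} →
         Γ ⊢s (M [ N ]) ·* Ns ∶ A → Γ ⊢s N ∶ B →
         Γ ⊢s ((ƛ M) · N) ·* Ns ∶ A
  L→   : ∀ {Γ Δ x y N Ns A₁ A₂ B} →
         Γ ⊢s N ∶ A₁ →
         ((y , A₂) ∷ Γ) ⊢s var y ·* Ns ∶ B →
         All (λ Nᵢ → ¬ (y ∈FV Nᵢ)) Ns →
         y ∉dom Γ →
         Δ ≋ ((x , A₁ ⇒ A₂) ∷ Γ) →
         Δ ⊢s (var x · N) ·* Ns ∶ B
  R→   : ∀ {Γ M A B} → ((0 , A) ∷ shiftCtx Γ) ⊢s M ∶ B → Γ ⊢s ƛ M ∶ A ⇒ B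
  L∩   : ∀ {Γ Δ x Ns A₁ A₂ B} →
         ((x , A₁) ∷ (x , A₂) ∷ Γ) ⊢s var x ·* Ns ∶ B →
         Δ ≋ ((x , A₁ ∩ A₂) ∷ Γ) →
         Δ ⊢s var x ·* Ns ∶ B
  R∩   : ∀ {Γ M A B} → Γ ⊢s M ∶ A → Γ ⊢s M ∶ B → Γ ⊢s M ∶ A ∩ B

-- Soundness: every rule of Λ∩ˢ is admissible in Λ∩. The left rules substitute into a typing of
-- y N₁ … Nₙ (x N for y in L→, x itself, projected by ∩E, in L∩), so one shows more generally that
-- Γ ⊢s M ∶ A gives Θ ⊢ M σ ∶ A for every σ typing Γ in Θ. Beta is subject expansion, which holds
-- in Λ∩ because the argument is typable: inverting the substitution lemma yields the types at which
-- the contractum uses the argument, and their intersection with B types the bound variable.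
-- Completeness: every rule of Λ∩ is admissible in Λ∩ˢ. A projection ∩E is pushed up to the axioms,
-- where it becomes an L∩. The rule →E is cut admissibility, by induction on the size of the cut type
-- and then on the derivation of the function: the application commutes with Beta and the left rules,
-- becomes an L→ at an axiom, and at an R→ becomes a Beta whose premise is a cut on the smaller
-- domain type. Finally, a variable has in Γ_∩ exactly intersections of the types Γ gives it.

module Submission where

open import Defs
open import Data.Empty using (⊥-elim)
open import Data.List using (List; []; _∷_; map; foldr; _++_; deduplicate)
open import Data.List.Membership.Propositional using (_∈_; _∉_)
open import Data.List.Membership.Propositional.Properties using (∈-++⁻; ∈-++⁺ˡ; ∈-++⁺ʳ; ∈-deduplicate⁻; ∈-deduplicate⁺)
open import Data.List.Relation.Binary.Subset.Propositional using (_⊆_)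
open import Data.List.Relation.Unary.All using (All; []; _∷_)
open import Data.List.Relation.Unary.Any using (here; there)
open import Data.Nat using (ℕ; zero; suc; _≟_; _+_; _⊔_; _≤_; _<_; s≤s)
open import Data.Nat.Properties using (≤-refl; ≤-trans; <-trans; <⇒≤; <-irrefl; n<1+n; m≤m⊔n; m≤n⊔m; m+n≤o⇒m≤o; m+n≤o⇒n≤o)
open import Data.Product using (Σ; _×_; _,_; proj₂)
open import Data.Sum using (_⊎_; inj₁; inj₂; [_,_]′)
open import Function using (id)
open import Relation.Nullary using (¬_; yes; no)
open import Relation.Binary.PropositionalEquality using (_≡_; _≢_; _≗_; refl; sym; trans; cong; cong₂)

rename-cong-fv : ∀ {ρ ρ'} M → (∀ z → z ∈FV M → ρ z ≡ ρ' z) → rename ρ M ≡ rename ρ' M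
rename-cong-fv (var x) h = cong var (h x fv-var)
rename-cong-fv (M · N) h = cong₂ _·_ (rename-cong-fv M λ z p → h z (fv-l p)) (rename-cong-fv N λ z p → h z (fv-r p))
rename-cong-fv (ƛ M) h = cong ƛ_ (rename-cong-fv M λ { zero _ → refl ; (suc z) p → cong suc (h z (fv-ƛ p)) })

subst-cong-fv : ∀ {σ τ} M → (∀ z → z ∈FV M → σ z ≡ τ z) → subst σ M ≡ subst τ M
subst-cong-fv (var x) h = h x fv-var
subst-cong-fv (M · N) h = cong₂ _·_ (subst-cong-fv M λ z p → h z (fv-l p)) (subst-cong-fv N λ z p → h z (fv-r p))
subst-cong-fv (ƛ M) h = cong ƛ_ (subst-cong-fv M λ { zero _ → refl ; (suc z) p → cong (rename suc) (h z (fv-ƛ p)) })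

rename-cong : ∀ {ρ ρ'} M → ρ ≗ ρ' → rename ρ M ≡ rename ρ' M
rename-cong M h = rename-cong-fv M λ z _ → h z

subst-cong : ∀ {σ τ} M → σ ≗ τ → subst σ M ≡ subst τ M
subst-cong M h = subst-cong-fv M λ z _ → h z

rename-id : ∀ M → rename id M ≡ M
rename-id (var x) = refl
rename-id (M · N) = cong₂ _·_ (rename-id M) (rename-id N)
rename-id (ƛ M) = cong ƛ_ (trans (rename-cong M λ { zero → refl ; (suc _) → refl }) (rename-id M))

subst-id : ∀ M → subst var M ≡ M
subst-id (var x) = refl
subst-id (M · N) = cong₂ _·_ (subst-id M) (subst-id N)
subst-id (ƛ M) = cong ƛ_ (trans (subst-cong M λ { zero → refl ; (suc _) → refl }) (subst-id M))

rename-rename : ∀ {ρ ρ'} M → rename ρ (rename ρ' M) ≡ rename (λ z → ρ (ρ' z)) M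
rename-rename (var x) = refl
rename-rename (M · N) = cong₂ _·_ (rename-rename M) (rename-rename N)
rename-rename (ƛ M) = cong ƛ_ (trans (rename-rename M) (rename-cong M λ { zero → refl ; (suc _) → refl }))

rename-subst : ∀ {ρ σ} M → rename ρ (subst σ M) ≡ subst (λ z → rename ρ (σ z)) M
rename-subst (var x) = refl
rename-subst (M · N) = cong₂ _·_ (rename-subst M) (rename-subst N)
rename-subst {σ = σ} (ƛ M) = cong ƛ_ (trans (rename-subst M) (subst-cong M λ
  { zero → refl ; (suc z) → trans (rename-rename (σ z)) (sym (rename-rename (σ z))) }))

subst-rename : ∀ {σ ρ} M → subst σ (rename ρ M) ≡ subst (λ z → σ (ρ z)) M
subst-rename (var x) = refl
subst-rename (M · N) = cong₂ _·_ (subst-rename M) (subst-rename N)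
subst-rename (ƛ M) = cong ƛ_ (trans (subst-rename M) (subst-cong M λ { zero → refl ; (suc _) → refl }))

subst-subst : ∀ {σ τ} M → subst σ (subst τ M) ≡ subst (λ z → subst σ (τ z)) M
subst-subst (var x) = refl
subst-subst (M · N) = cong₂ _·_ (subst-subst M) (subst-subst N)
subst-subst {τ = τ} (ƛ M) = cong ƛ_ (trans (subst-subst M) (subst-cong M λ
  { zero → refl ; (suc z) → trans (subst-rename (τ z)) (sym (rename-subst (τ z))) }))

rename-[] : ∀ ρ P Q → rename ρ (P [ Q ]) ≡ rename (ext ρ) P [ rename ρ Q ]
rename-[] ρ P Q = trans (rename-subst P) (trans (subst-cong P λ { zero → refl ; (suc _) → refl }) (sym (subst-rename P)))

subst-[] : ∀ σ P Q → subst σ (P [ Q ]) ≡ subst (exts σ) P [ subst σ Q ]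
subst-[] σ P Q = trans (subst-subst P) (trans (subst-cong P λ
  { zero → refl ; (suc z) → sym (trans (subst-rename (σ z)) (subst-id (σ z))) }) (sym (subst-subst P)))

cons : Term → (ℕ → ℕ) → ℕ → Term
cons N ρ zero = N
cons N ρ (suc z) = var (ρ z)

subst-cons : ∀ N ρ P → subst (cons N ρ) P ≡ rename (ext ρ) P [ N ]
subst-cons N ρ P = trans (subst-cong P λ { zero → refl ; (suc _) → refl }) (sym (subst-rename P))

rename-·* : ∀ ρ M Ns → rename ρ (M ·* Ns) ≡ rename ρ M ·* map (rename ρ) Ns
rename-·* ρ M [] = refl
rename-·* ρ M (N ∷ Ns) = rename-·* ρ (M · N) Ns

subst-·* : ∀ σ M Ns → subst σ (M ·* Ns) ≡ subst σ M ·* map (subst σ) Ns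
subst-·* σ M [] = refl
subst-·* σ M (N ∷ Ns) = subst-·* σ (M · N) Ns

·*-snoc : ∀ M Ns N → M ·* (Ns ++ N ∷ []) ≡ (M ·* Ns) · N
·*-snoc M [] N = refl
·*-snoc M (N' ∷ Ns) N = ·*-snoc (M · N') Ns N

rename-·*-snoc : ∀ ρ M Ns N → rename ρ (M ·* Ns) · N ≡ rename ρ M ·* (map (rename ρ) Ns ++ N ∷ [])
rename-·*-snoc ρ M Ns N = trans (cong (_· N) (rename-·* ρ M Ns)) (sym (·*-snoc (rename ρ M) (map (rename ρ) Ns) N))

update : {X : Set} → (ℕ → X) → ℕ → X → ℕ → X
update f y v z with z ≟ y
... | yes _ = v
... | no _ = f z

update-≡ : ∀ {X : Set} (f : ℕ → X) y v → update f y v y ≡ v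
update-≡ f y v with y ≟ y
... | yes _ = refl
... | no y≢y = ⊥-elim (y≢y refl)

update-≢ : ∀ {X : Set} (f : ℕ → X) y v {z} → z ≢ y → update f y v z ≡ f z
update-≢ f y v {z} z≢y with z ≟ y
... | yes z≡y = ⊥-elim (z≢y z≡y)
... | no _ = refl

∉FV⇒≢ : ∀ {y z M} → ¬ (y ∈FV M) → z ∈FV M → z ≢ y
∉FV⇒≢ y∉M z∈M refl = y∉M z∈M

map-rename-update : ∀ ρ y y' Ns → All (λ N → ¬ (y ∈FV N)) Ns → map (rename (update ρ y y')) Ns ≡ map (rename ρ) Ns
map-rename-update ρ y y' [] [] = refl
map-rename-update ρ y y' (N ∷ Ns) (y∉N ∷ y∉Ns) =
  cong₂ _∷_ (rename-cong-fv N λ z p → update-≢ ρ y y' (∉FV⇒≢ y∉N p)) (map-rename-update ρ y y' Ns y∉Ns)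

map-subst-update : ∀ σ y T Ns → All (λ N → ¬ (y ∈FV N)) Ns → map (subst (update σ y T)) Ns ≡ map (subst σ) Ns
map-subst-update σ y T [] [] = refl
map-subst-update σ y T (N ∷ Ns) (y∉N ∷ y∉Ns) =
  cong₂ _∷_ (subst-cong-fv N λ z p → update-≢ σ y T (∉FV⇒≢ y∉N p)) (map-subst-update σ y T Ns y∉Ns)

rename-update-·* : ∀ ρ y y' Ns → All (λ N → ¬ (y ∈FV N)) Ns →
                   rename (update ρ y y') (var y ·* Ns) ≡ var y' ·* map (rename ρ) Ns
rename-update-·* ρ y y' Ns y∉Ns =
  trans (rename-·* _ (var y) Ns) (cong₂ _·*_ (cong var (update-≡ ρ y y')) (map-rename-update ρ y y' Ns y∉Ns))

subst-update-·* : ∀ σ y T Ns → All (λ N → ¬ (y ∈FV N)) Ns →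
                  subst (update σ y T) (var y ·* Ns) ≡ T ·* map (subst σ) Ns
subst-update-·* σ y T Ns y∉Ns =
  trans (subst-·* _ (var y) Ns) (cong₂ _·*_ (update-≡ σ y T) (map-subst-update σ y T Ns y∉Ns))

fvBound : Term → ℕ
fvBound (var x) = suc x
fvBound (M · N) = fvBound M ⊔ fvBound N
fvBound (ƛ M) = fvBound M

∈FV⇒<fvBound : ∀ {z} M → z ∈FV M → z < fvBound M
∈FV⇒<fvBound (var x) fv-var = ≤-refl
∈FV⇒<fvBound (M · N) (fv-l p) = ≤-trans (∈FV⇒<fvBound M p) (m≤m⊔n _ _)
∈FV⇒<fvBound (M · N) (fv-r p) = ≤-trans (∈FV⇒<fvBound N p) (m≤n⊔m _ _)
∈FV⇒<fvBound (ƛ M) (fv-ƛ p) = <-trans (n<1+n _) (∈FV⇒<fvBound M p)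

fvBound* : List Term → ℕ
fvBound* [] = 0
fvBound* (M ∷ Ms) = fvBound M ⊔ fvBound* Ms

fvBound*≤⇒∉FV : ∀ {y} Ms → fvBound* Ms ≤ y → All (λ N → ¬ (y ∈FV N)) Ms
fvBound*≤⇒∉FV [] _ = []
fvBound*≤⇒∉FV (M ∷ Ms) le =
  (λ p → <-irrefl refl (≤-trans (∈FV⇒<fvBound M p) (≤-trans (m≤m⊔n _ _) le)))
  ∷ fvBound*≤⇒∉FV Ms (≤-trans (m≤n⊔m (fvBound M) _) le)

domBound : Ctx → ℕ
domBound [] = 0
domBound ((z , _) ∷ Γ) = suc z ⊔ domBound Γ

∈⇒<domBound : ∀ {z C} Γ → (z , C) ∈ Γ → z < domBound Γ
∈⇒<domBound ((z , _) ∷ Γ) (here refl) = m≤m⊔n (suc z) (domBound Γ)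
∈⇒<domBound (_ ∷ Γ) (there p) = ≤-trans (∈⇒<domBound Γ p) (m≤n⊔m _ _)

fresh : Ctx → List Term → ℕ
fresh Γ Ms = domBound Γ ⊔ fvBound* Ms

fresh-∉dom : ∀ Γ Ms → fresh Γ Ms ∉dom Γ
fresh-∉dom Γ Ms B p = <-irrefl refl (≤-trans (∈⇒<domBound Γ p) (m≤m⊔n _ _))

fresh-∉FV : ∀ Γ Ms → All (λ N → ¬ (fresh Γ Ms ∈FV N)) Ms
fresh-∉FV Γ Ms = fvBound*≤⇒∉FV Ms (m≤n⊔m (domBound Γ) _)

0∉shiftCtx : ∀ {C} Γ → (0 , C) ∉ shiftCtx Γ
0∉shiftCtx (_ ∷ Γ) (there p) = 0∉shiftCtx Γ p

∈-shiftCtx⁻ : ∀ {z C} Γ → (suc z , C) ∈ shiftCtx Γ → (z , C) ∈ Γ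
∈-shiftCtx⁻ (_ ∷ Γ) (here refl) = here refl
∈-shiftCtx⁻ (_ ∷ Γ) (there p) = there (∈-shiftCtx⁻ Γ p)

∈-shiftCtx⁺ : ∀ {z C} Γ → (z , C) ∈ Γ → (suc z , C) ∈ shiftCtx Γ
∈-shiftCtx⁺ (_ ∷ Γ) (here refl) = here refl
∈-shiftCtx⁺ (_ ∷ Γ) (there p) = there (∈-shiftCtx⁺ Γ p)

binder-elim : ∀ {A Γ} (P : ℕ → Type → Set) → P 0 A → (∀ {z C} → (z , C) ∈ Γ → P (suc z) C) →
              ∀ {z C} → (z , C) ∈ (0 , A) ∷ shiftCtx Γ → P z C
binder-elim P p₀ pₛ {zero} (here refl) = p₀
binder-elim {Γ = Γ} P p₀ pₛ {zero} (there p) = ⊥-elim (0∉shiftCtx Γ p)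
binder-elim {Γ = Γ} P p₀ pₛ {suc z} (there p) = pₛ (∈-shiftCtx⁻ Γ p)

≋-cons-∈ : ∀ {x C Γ} → (x , C) ∈ Γ → Γ ≋ ((x , C) ∷ Γ)
≋-cons-∈ m = there , λ { (here refl) → m ; (there q) → q }

≋-head : ∀ {Δ x C Γ} → Δ ≋ ((x , C) ∷ Γ) → (x , C) ∈ Δ
≋-head eq = proj₂ eq (here refl)

≋-tail : ∀ {Δ x C Γ} → Δ ≋ ((x , C) ∷ Γ) → Γ ⊆ Δ
≋-tail eq p = proj₂ eq (there p)

Renaming : Ctx → Ctx → (ℕ → ℕ) → Set
Renaming Δ Γ ρ = ∀ {z C} → (z , C) ∈ Δ → (ρ z , C) ∈ Γ

Renaming-ext : ∀ {Δ Γ ρ A} → Renaming Δ Γ ρ → Renaming ((0 , A) ∷ shiftCtx Δ) ((0 , A) ∷ shiftCtx Γ) (ext ρ)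
Renaming-ext {Γ = Γ} {ρ} {A} h =
  binder-elim (λ z C → (ext ρ z , C) ∈ (0 , A) ∷ shiftCtx Γ) (here refl) λ p → there (∈-shiftCtx⁺ Γ (h p))

Renaming-suc : ∀ {Γ A} → Renaming Γ ((0 , A) ∷ shiftCtx Γ) suc
Renaming-suc {Γ} p = there (∈-shiftCtx⁺ Γ p)

Renaming-update : ∀ {Δ Γ ρ y y' A} → Renaming Δ Γ ρ → y ∉dom Δ → Renaming ((y , A) ∷ Δ) ((y' , A) ∷ Γ) (update ρ y y')
Renaming-update {ρ = ρ} {y} {y'} h y∉Δ (here refl) = here (cong (_, _) (update-≡ ρ y y'))
Renaming-update {ρ = ρ} {y} {y'} h y∉Δ {z} {C} (there p)
  rewrite update-≢ ρ y y' {z} (λ { refl → y∉Δ C p }) = there (h p)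

Renaming-L∩ : ∀ {Δ Δ' Γ ρ x A₁ A₂} → Renaming Δ Γ ρ → Δ ≋ ((x , A₁ ∩ A₂) ∷ Δ') →
              Renaming ((x , A₁) ∷ (x , A₂) ∷ Δ') ((ρ x , A₁) ∷ (ρ x , A₂) ∷ Γ) ρ
Renaming-L∩ h eq (here refl) = here refl
Renaming-L∩ h eq (there (here refl)) = there (here refl)
Renaming-L∩ h eq (there (there p)) = there (there (h (≋-tail eq p)))

⊢s-cast : ∀ {Γ M M' A} → M ≡ M' → Γ ⊢s M ∶ A → Γ ⊢s M' ∶ A
⊢s-cast refl d = d

⊢s-rename : ∀ {Δ Γ ρ M A} → Δ ⊢s M ∶ A → Renaming Δ Γ ρ → Γ ⊢s rename ρ M ∶ A
⊢s-rename (Ax m) h = Ax (h m)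
⊢s-rename (R→ d) h = R→ (⊢s-rename d (Renaming-ext h))
⊢s-rename (R∩ d₁ d₂) h = R∩ (⊢s-rename d₁ h) (⊢s-rename d₂ h)
⊢s-rename {ρ = ρ} (Beta {M = P} {N = Q} {Ns = Ns} d₁ d₂) h =
  ⊢s-cast (sym (rename-·* ρ ((ƛ P) · Q) Ns))
    (Beta {M = rename (ext ρ) P} {N = rename ρ Q} {Ns = map (rename ρ) Ns}
      (⊢s-cast (trans (rename-·* ρ (P [ Q ]) Ns) (cong (_·* map (rename ρ) Ns) (rename-[] ρ P Q))) (⊢s-rename d₁ h))
      (⊢s-rename d₂ h))
⊢s-rename {Γ = Γ} {ρ} (L→ {Γ = Δ'} {x = x} {y} {N} {Ns} dN dy y∉Ns y∉Δ' eq) h =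
  ⊢s-cast (sym (rename-·* ρ (var x · N) Ns))
    (L→ {Γ = Γ} {y = y'} (⊢s-rename dN h')
        (⊢s-cast (rename-update-·* ρ y y' Ns y∉Ns) (⊢s-rename dy (Renaming-update h' y∉Δ')))
        (fresh-∉FV Γ Ms) (fresh-∉dom Γ Ms) (≋-cons-∈ (h (≋-head eq))))
  where
  Ms = map (rename ρ) Ns
  y' = fresh Γ Ms
  h' : Renaming Δ' Γ ρ
  h' p = h (≋-tail eq p)
⊢s-rename {Γ = Γ} {ρ} (L∩ {x = x} {Ns} d eq) h =
  ⊢s-cast (sym (rename-·* ρ (var x) Ns))
    (L∩ {Γ = Γ} {Ns = map (rename ρ) Ns}
      (⊢s-cast (rename-·* ρ (var x) Ns) (⊢s-rename d (Renaming-L∩ h eq))) (≋-cons-∈ (h (≋-head eq))))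

⊢s-weaken : ∀ {Γ Γ' M A} → Γ ⊢s M ∶ A → Γ ⊆ Γ' → Γ' ⊢s M ∶ A
⊢s-weaken {M = M} d Γ⊆Γ' = ⊢s-cast (rename-id M) (⊢s-rename d Γ⊆Γ')

⊢s-∩E₁ : ∀ {Γ M A B} → Γ ⊢s M ∶ A ∩ B → Γ ⊢s M ∶ A
⊢s-∩E₁ (Ax m) = L∩ {Ns = []} (Ax (here refl)) (≋-cons-∈ m)
⊢s-∩E₁ (Beta {M = P} {N = Q} {Ns = Ns} d₁ d₂) = Beta {M = P} {N = Q} {Ns = Ns} (⊢s-∩E₁ d₁) d₂
⊢s-∩E₁ (L→ {x = x} {N = N} {Ns = Ns} dN dy y∉Ns y∉Γ eq) = L→ {x = x} {N = N} {Ns = Ns} dN (⊢s-∩E₁ dy) y∉Ns y∉Γ eq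
⊢s-∩E₁ (L∩ {x = x} {Ns = Ns} d eq) = L∩ {x = x} {Ns = Ns} (⊢s-∩E₁ d) eq
⊢s-∩E₁ (R∩ d₁ d₂) = d₁

⊢s-∩E₂ : ∀ {Γ M A B} → Γ ⊢s M ∶ A ∩ B → Γ ⊢s M ∶ B
⊢s-∩E₂ (Ax m) = L∩ {Ns = []} (Ax (there (here refl))) (≋-cons-∈ m)
⊢s-∩E₂ (Beta {M = P} {N = Q} {Ns = Ns} d₁ d₂) = Beta {M = P} {N = Q} {Ns = Ns} (⊢s-∩E₂ d₁) d₂
⊢s-∩E₂ (L→ {x = x} {N = N} {Ns = Ns} dN dy y∉Ns y∉Γ eq) = L→ {x = x} {N = N} {Ns = Ns} dN (⊢s-∩E₂ dy) y∉Ns y∉Γ eq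
⊢s-∩E₂ (L∩ {x = x} {Ns = Ns} d eq) = L∩ {x = x} {Ns = Ns} (⊢s-∩E₂ d) eq
⊢s-∩E₂ (R∩ d₁ d₂) = d₂

-- Cut admissibility in Λ∩ˢ

size : Type → ℕ
size (atom _) = 1
size (A ⇒ B) = suc (size A + size B)
size (A ∩ B) = suc (size A + size B)

-- Variables may be sent to variables of any type, so that renamings are cut substitutions;
-- proper cuts are on types of size at most n.
CutEntry : ℕ → Ctx → Term → Type → Set
CutEntry n Γ P C = (Σ ℕ λ z → (P ≡ var z) × ((z , C) ∈ Γ)) ⊎ ((size C ≤ n) × (Γ ⊢s P ∶ C))

CutSubst : ℕ → Ctx → Ctx → (ℕ → Term) → Set
CutSubst n Δ Γ σ = ∀ {z C} → (z , C) ∈ Δ → CutEntry n Γ (σ z) C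

CutEntry-rename : ∀ {n Γ Γ' ρ P C} → Renaming Γ Γ' ρ → CutEntry n Γ P C → CutEntry n Γ' (rename ρ P) C
CutEntry-rename {ρ = ρ} h (inj₁ (z , refl , m)) = inj₁ (ρ z , refl , h m)
CutEntry-rename h (inj₂ (le , d)) = inj₂ (le , ⊢s-rename d h)

CutEntry-weaken : ∀ {n Γ Γ' P C} → Γ ⊆ Γ' → CutEntry n Γ P C → CutEntry n Γ' P C
CutEntry-weaken Γ⊆Γ' (inj₁ (z , e , m)) = inj₁ (z , e , Γ⊆Γ' m)
CutEntry-weaken Γ⊆Γ' (inj₂ (le , d)) = inj₂ (le , ⊢s-weaken d Γ⊆Γ')

CutSubst-exts : ∀ {n Δ Γ σ A} → CutSubst n Δ Γ σ → CutSubst n ((0 , A) ∷ shiftCtx Δ) ((0 , A) ∷ shiftCtx Γ) (exts σ)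
CutSubst-exts {n} {Γ = Γ} {σ} {A} h =
  binder-elim (λ z C → CutEntry n ((0 , A) ∷ shiftCtx Γ) (exts σ z) C) (inj₁ (0 , refl , here refl))
    λ p → CutEntry-rename Renaming-suc (h p)

CutSubst-update : ∀ {n Δ Γ σ y T A} → CutSubst n Δ Γ σ → y ∉dom Δ → CutEntry n Γ T A →
                  CutSubst n ((y , A) ∷ Δ) Γ (update σ y T)
CutSubst-update {σ = σ} {y} {T} h y∉Δ e (here refl) rewrite update-≡ σ y T = e
CutSubst-update {σ = σ} {y} {T} h y∉Δ e {z} {C} (there p) rewrite update-≢ σ y T {z} (λ { refl → y∉Δ C p }) = h p

-- ⊢s-app at bound n + 1 calls ⊢s-cut at bound n only; all other calls are on subderivations.
mutual
  ⊢s-app : ∀ n {Δ Γ ρ M N A B} → size (A ⇒ B) ≤ n → Δ ⊢s M ∶ A ⇒ B → Renaming Δ Γ ρ → Γ ⊢s N ∶ A →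
           Γ ⊢s rename ρ M · N ∶ B
  ⊢s-app zero () _ _ _
  ⊢s-app (suc n) {Γ = Γ} _ (Ax m) h dN =
    L→ {Γ = Γ} {y = fresh Γ []} {Ns = []} dN (Ax (here refl)) [] (fresh-∉dom Γ []) (≋-cons-∈ (h m))
  ⊢s-app (suc n) {Δ} {Γ} {ρ} {N = N} {A} (s≤s le) (R→ {M = P} d) h dN =
    Beta {M = rename (ext ρ) P} {N = N} {Ns = []} (⊢s-cast (subst-cons N ρ P) (⊢s-cut n d σ-ok)) dN
    where
    σ-ok : CutSubst n ((0 , A) ∷ shiftCtx Δ) Γ (cons N ρ)
    σ-ok = binder-elim (λ z C → CutEntry n Γ (cons N ρ z) C) (inj₂ (m+n≤o⇒m≤o (size A) le , dN))
             λ p → inj₁ (_ , refl , h p)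
  ⊢s-app (suc n) {ρ = ρ} {N = N} le (Beta {M = P} {N = Q} {Ns = Ns} d₁ d₂) h dN =
    ⊢s-cast (sym (rename-·*-snoc ρ ((ƛ P) · Q) Ns N))
      (Beta {M = rename (ext ρ) P} {N = rename ρ Q} {Ns = map (rename ρ) Ns ++ N ∷ []}
        (⊢s-cast (trans (rename-·*-snoc ρ (P [ Q ]) Ns N) (cong (_·* (map (rename ρ) Ns ++ N ∷ [])) (rename-[] ρ P Q)))
          (⊢s-app (suc n) le d₁ h dN))
        (⊢s-rename d₂ h))
  ⊢s-app (suc n) {Γ = Γ} {ρ} {N = N} le (L→ {Γ = Δ'} {x = x} {y} {N'} {Ns} dN' dy y∉Ns y∉Δ' eq) h dN =
    ⊢s-cast (sym (rename-·*-snoc ρ (var x · N') Ns N))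
      (L→ {Γ = Γ} {y = y'} {N = rename ρ N'} {Ns = Ms}
        (⊢s-rename dN' h')
        (⊢s-cast e (⊢s-app (suc n) le dy (Renaming-update h' y∉Δ') (⊢s-weaken dN there)))
        (fresh-∉FV Γ Ms) (fresh-∉dom Γ Ms) (≋-cons-∈ (h (≋-head eq))))
    where
    Ms = map (rename ρ) Ns ++ N ∷ []
    y' = fresh Γ Ms
    h' : Renaming Δ' Γ ρ
    h' p = h (≋-tail eq p)
    e : rename (update ρ y y') (var y ·* Ns) · N ≡ var y' ·* Ms
    e = trans (cong (_· N) (rename-update-·* ρ y y' Ns y∉Ns)) (sym (·*-snoc (var y') (map (rename ρ) Ns) N))
  ⊢s-app (suc n) {Γ = Γ} {ρ} {N = N} le (L∩ {x = x} {Ns} d eq) h dN =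
    ⊢s-cast (sym (rename-·*-snoc ρ (var x) Ns N))
      (L∩ {Γ = Γ} {Ns = map (rename ρ) Ns ++ N ∷ []}
        (⊢s-cast (rename-·*-snoc ρ (var x) Ns N) (⊢s-app (suc n) le d (Renaming-L∩ h eq) (⊢s-weaken dN λ p → there (there p))))
        (≋-cons-∈ (h (≋-head eq))))

  ⊢s-cut : ∀ n {Δ Γ σ M A} → Δ ⊢s M ∶ A → CutSubst n Δ Γ σ → Γ ⊢s subst σ M ∶ A
  ⊢s-cut n (Ax m) h with h m
  ... | inj₁ (z , e , m') = ⊢s-cast (sym e) (Ax m')
  ... | inj₂ (_ , d) = d
  ⊢s-cut n (R→ d) h = R→ (⊢s-cut n d (CutSubst-exts h))
  ⊢s-cut n (R∩ d₁ d₂) h = R∩ (⊢s-cut n d₁ h) (⊢s-cut n d₂ h)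
  ⊢s-cut n {σ = σ} (Beta {M = P} {N = Q} {Ns = Ns} d₁ d₂) h =
    ⊢s-cast (sym (subst-·* σ ((ƛ P) · Q) Ns))
      (Beta {M = subst (exts σ) P} {N = subst σ Q} {Ns = map (subst σ) Ns}
        (⊢s-cast (trans (subst-·* σ (P [ Q ]) Ns) (cong (_·* map (subst σ) Ns) (subst-[] σ P Q))) (⊢s-cut n d₁ h))
        (⊢s-cut n d₂ h))
  ⊢s-cut n {Γ = Γ} {σ} (L∩ {Γ = Δ'} {x = x} {Ns} {A₁} {A₂} d eq) h with h (≋-head eq)
  ... | inj₁ (z , e , m) =
    ⊢s-cast (sym e') (L∩ {Γ = Γ} {x = z} {Ns = map (subst σ) Ns} (⊢s-cast e' (⊢s-cut n d h')) (≋-cons-∈ m))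
    where
    e' : subst σ (var x ·* Ns) ≡ var z ·* map (subst σ) Ns
    e' = trans (subst-·* σ (var x) Ns) (cong (_·* map (subst σ) Ns) e)
    h' : CutSubst n ((x , A₁) ∷ (x , A₂) ∷ Δ') ((z , A₁) ∷ (z , A₂) ∷ Γ) σ
    h' (here refl) = inj₁ (z , e , here refl)
    h' (there (here refl)) = inj₁ (z , e , there (here refl))
    h' (there (there p)) = CutEntry-weaken (λ q → there (there q)) (h (≋-tail eq p))
  ... | inj₂ (le , dx) = ⊢s-cut n d h'
    where
    h' : CutSubst n ((x , A₁) ∷ (x , A₂) ∷ Δ') Γ σ
    h' (here refl) = inj₂ (m+n≤o⇒m≤o (size A₁) (<⇒≤ le) , ⊢s-∩E₁ dx)
    h' (there (here refl)) = inj₂ (m+n≤o⇒n≤o (size A₁) (<⇒≤ le) , ⊢s-∩E₂ dx)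
    h' (there (there p)) = h (≋-tail eq p)
  ⊢s-cut n {Γ = Γ} {σ} (L→ {Γ = Δ'} {x = x} {y} {N'} {Ns} {A₁} {A₂} dN' dy y∉Ns y∉Δ' eq) h
    with h (≋-head eq)
  ... | inj₁ (z , e , m) =
    ⊢s-cast (sym e')
      (L→ {Γ = Γ} {y = y'} {N = subst σ N'} {Ns = Ms}
        (⊢s-cut n dN' h-tail) (⊢s-cast (subst-update-·* σ y (var y') Ns y∉Ns) (⊢s-cut n dy h'))
        (fresh-∉FV Γ Ms) (fresh-∉dom Γ Ms) (≋-cons-∈ m))
    where
    Ms = map (subst σ) Ns
    y' = fresh Γ Ms
    h-tail : CutSubst n Δ' Γ σ
    h-tail p = h (≋-tail eq p)
    e' : subst σ ((var x · N') ·* Ns) ≡ (var z · subst σ N') ·* Ms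
    e' = trans (subst-·* σ (var x · N') Ns) (cong (λ M → (M · subst σ N') ·* Ms) e)
    h' : CutSubst n ((y , A₂) ∷ Δ') ((y' , A₂) ∷ Γ) (update σ y (var y'))
    h' = CutSubst-update (λ p → CutEntry-weaken there (h-tail p)) y∉Δ' (inj₁ (y' , refl , here refl))
  ... | inj₂ (le , dx) = ⊢s-cast e' (⊢s-cut n dy h')
    where
    xN = σ x · subst σ N'
    h-tail : CutSubst n Δ' Γ σ
    h-tail p = h (≋-tail eq p)
    dxN : Γ ⊢s xN ∶ A₂
    dxN = ⊢s-cast (cong (_· subst σ N') (rename-id (σ x))) (⊢s-app n le dx (λ p → p) (⊢s-cut n dN' h-tail))
    h' : CutSubst n ((y , A₂) ∷ Δ') Γ (update σ y xN)
    h' = CutSubst-update h-tail y∉Δ' (inj₂ (m+n≤o⇒n≤o (size A₁) (<⇒≤ le) , dxN))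
    e' : subst (update σ y xN) (var y ·* Ns) ≡ subst σ ((var x · N') ·* Ns)
    e' = trans (subst-update-·* σ y xN Ns y∉Ns) (sym (subst-·* σ (var x · N') Ns))

⊢s-→E : ∀ {Γ M N A B} → Γ ⊢s M ∶ A ⇒ B → Γ ⊢s N ∶ A → Γ ⊢s M · N ∶ B
⊢s-→E {M = M} {A = A} {B} dM dN =
  ⊢s-cast (cong (_· _) (rename-id M)) (⊢s-app (size (A ⇒ B)) ≤-refl dM (λ p → p) dN)

-- Substitution, its inverse, and subject expansion in Λ∩

⊢-cast : ∀ {Γ M M' A} → M ≡ M' → Γ ⊢ M ∶ A → Γ ⊢ M' ∶ A
⊢-cast refl d = d

⊢-rename : ∀ {Δ Γ ρ M A} → Δ ⊢ M ∶ A → Renaming Δ Γ ρ → Γ ⊢ rename ρ M ∶ A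
⊢-rename (Ax m) h = Ax (h m)
⊢-rename (→I d) h = →I (⊢-rename d (Renaming-ext h))
⊢-rename (→E d₁ d₂) h = →E (⊢-rename d₁ h) (⊢-rename d₂ h)
⊢-rename (∩I d₁ d₂) h = ∩I (⊢-rename d₁ h) (⊢-rename d₂ h)
⊢-rename (∩E₁ d) h = ∩E₁ (⊢-rename d h)
⊢-rename (∩E₂ d) h = ∩E₂ (⊢-rename d h)

⊢-weaken : ∀ {Γ Γ' M A} → Γ ⊢ M ∶ A → Γ ⊆ Γ' → Γ' ⊢ M ∶ A
⊢-weaken {M = M} d Γ⊆Γ' = ⊢-cast (rename-id M) (⊢-rename d Γ⊆Γ')

ReflectsRenaming : Ctx → Ctx → (ℕ → ℕ) → Set
ReflectsRenaming Θ' Θ ρ = ∀ {z D} → (ρ z , D) ∈ Θ' → (z , D) ∈ Θ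

ReflectsRenaming-ext : ∀ {Θ' Θ ρ A} → ReflectsRenaming Θ' Θ ρ →
                       ReflectsRenaming ((0 , A) ∷ shiftCtx Θ') ((0 , A) ∷ shiftCtx Θ) (ext ρ)
ReflectsRenaming-ext h {zero} (here refl) = here refl
ReflectsRenaming-ext {Θ'} h {zero} (there p) = ⊥-elim (0∉shiftCtx Θ' p)
ReflectsRenaming-ext {Θ'} {Θ} h {suc z} (there p) = there (∈-shiftCtx⁺ Θ (h (∈-shiftCtx⁻ Θ' p)))

⊢-rename⁻¹ : ∀ {Θ' Θ ρ C} M → Θ' ⊢ rename ρ M ∶ C → ReflectsRenaming Θ' Θ ρ → Θ ⊢ M ∶ C
⊢-rename⁻¹ (var z) (Ax m) h = Ax (h m)
⊢-rename⁻¹ (var z) (∩I d₁ d₂) h = ∩I (⊢-rename⁻¹ (var z) d₁ h) (⊢-rename⁻¹ (var z) d₂ h)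
⊢-rename⁻¹ (var z) (∩E₁ d) h = ∩E₁ (⊢-rename⁻¹ (var z) d h)
⊢-rename⁻¹ (var z) (∩E₂ d) h = ∩E₂ (⊢-rename⁻¹ (var z) d h)
⊢-rename⁻¹ (M · N) (→E d₁ d₂) h = →E (⊢-rename⁻¹ M d₁ h) (⊢-rename⁻¹ N d₂ h)
⊢-rename⁻¹ (M · N) (∩I d₁ d₂) h = ∩I (⊢-rename⁻¹ (M · N) d₁ h) (⊢-rename⁻¹ (M · N) d₂ h)
⊢-rename⁻¹ (M · N) (∩E₁ d) h = ∩E₁ (⊢-rename⁻¹ (M · N) d h)
⊢-rename⁻¹ (M · N) (∩E₂ d) h = ∩E₂ (⊢-rename⁻¹ (M · N) d h)
⊢-rename⁻¹ (ƛ M) (→I d) h = →I (⊢-rename⁻¹ M d (ReflectsRenaming-ext h))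
⊢-rename⁻¹ (ƛ M) (∩I d₁ d₂) h = ∩I (⊢-rename⁻¹ (ƛ M) d₁ h) (⊢-rename⁻¹ (ƛ M) d₂ h)
⊢-rename⁻¹ (ƛ M) (∩E₁ d) h = ∩E₁ (⊢-rename⁻¹ (ƛ M) d h)
⊢-rename⁻¹ (ƛ M) (∩E₂ d) h = ∩E₂ (⊢-rename⁻¹ (ƛ M) d h)

⊢-var-transfer : ∀ {Θ Θ' z C} → Θ ⊢ var z ∶ C → (∀ {D} → (z , D) ∈ Θ → (z , D) ∈ Θ') → Θ' ⊢ var z ∶ C
⊢-var-transfer (Ax m) h = Ax (h m)
⊢-var-transfer (∩I d₁ d₂) h = ∩I (⊢-var-transfer d₁ h) (⊢-var-transfer d₂ h)
⊢-var-transfer (∩E₁ d) h = ∩E₁ (⊢-var-transfer d h)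
⊢-var-transfer (∩E₂ d) h = ∩E₂ (⊢-var-transfer d h)

TypedSubst : Ctx → Ctx → (ℕ → Term) → Set
TypedSubst Δ Γ σ = ∀ {z C} → (z , C) ∈ Δ → Γ ⊢ σ z ∶ C

TypedSubst-exts : ∀ {Δ Γ σ A} → TypedSubst Δ Γ σ → TypedSubst ((0 , A) ∷ shiftCtx Δ) ((0 , A) ∷ shiftCtx Γ) (exts σ)
TypedSubst-exts {Γ = Γ} {σ} {A} h =
  binder-elim (λ z C → (0 , A) ∷ shiftCtx Γ ⊢ exts σ z ∶ C) (Ax (here refl)) λ p → ⊢-rename (h p) Renaming-suc

TypedSubst-update : ∀ {Δ Γ σ y T A} → TypedSubst Δ Γ σ → y ∉dom Δ → Γ ⊢ T ∶ A →
                    TypedSubst ((y , A) ∷ Δ) Γ (update σ y T)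
TypedSubst-update {σ = σ} {y} {T} h y∉Δ d (here refl) rewrite update-≡ σ y T = d
TypedSubst-update {σ = σ} {y} {T} h y∉Δ d {z} {C} (there p) rewrite update-≢ σ y T {z} (λ { refl → y∉Δ C p }) = h p

⊢-subst : ∀ {Δ Γ σ M A} → Δ ⊢ M ∶ A → TypedSubst Δ Γ σ → Γ ⊢ subst σ M ∶ A
⊢-subst (Ax m) h = h m
⊢-subst (→I d) h = →I (⊢-subst d (TypedSubst-exts h))
⊢-subst (→E d₁ d₂) h = →E (⊢-subst d₁ h) (⊢-subst d₂ h)
⊢-subst (∩I d₁ d₂) h = ∩I (⊢-subst d₁ h) (⊢-subst d₂ h)
⊢-subst (∩E₁ d) h = ∩E₁ (⊢-subst d h)
⊢-subst (∩E₂ d) h = ∩E₂ (⊢-subst d h)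

Unsubst : Ctx → (ℕ → Term) → Term → Type → Set
Unsubst Θ σ P A = Σ Ctx λ Ξ → (Ξ ⊢ P ∶ A) × TypedSubst Ξ Θ σ

unsubst-merge : ∀ {Θ σ P Q A B} → Unsubst Θ σ P A → Unsubst Θ σ Q B →
                Σ Ctx λ Ξ → (Ξ ⊢ P ∶ A) × (Ξ ⊢ Q ∶ B) × TypedSubst Ξ Θ σ
unsubst-merge (Ξ₁ , d₁ , h₁) (Ξ₂ , d₂ , h₂) =
  Ξ₁ ++ Ξ₂ , ⊢-weaken d₁ ∈-++⁺ˡ , ⊢-weaken d₂ (∈-++⁺ʳ Ξ₁) , λ p → [ h₁ , h₂ ]′ (∈-++⁻ Ξ₁ p)

unsubst-→E : ∀ {Θ σ P Q A B} → Unsubst Θ σ P (A ⇒ B) → Unsubst Θ σ Q A → Unsubst Θ σ (P · Q) B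
unsubst-→E u v = let Ξ , d₁ , d₂ , h = unsubst-merge u v in Ξ , →E d₁ d₂ , h

unsubst-∩I : ∀ {Θ σ P A B} → Unsubst Θ σ P A → Unsubst Θ σ P B → Unsubst Θ σ P (A ∩ B)
unsubst-∩I u v = let Ξ , d₁ , d₂ , h = unsubst-merge u v in Ξ , ∩I d₁ d₂ , h

unsubst-∩E₁ : ∀ {Θ σ P A B} → Unsubst Θ σ P (A ∩ B) → Unsubst Θ σ P A
unsubst-∩E₁ (Ξ , d , h) = Ξ , ∩E₁ d , h

unsubst-∩E₂ : ∀ {Θ σ P A B} → Unsubst Θ σ P (A ∩ B) → Unsubst Θ σ P B
unsubst-∩E₂ (Ξ , d , h) = Ξ , ∩E₂ d , h

unshiftCtx : Ctx → Ctx
unshiftCtx [] = []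
unshiftCtx ((zero , C) ∷ Ξ) = unshiftCtx Ξ
unshiftCtx ((suc z , C) ∷ Ξ) = (z , C) ∷ unshiftCtx Ξ

∈-unshiftCtx⁻ : ∀ {z C} Ξ → (z , C) ∈ unshiftCtx Ξ → (suc z , C) ∈ Ξ
∈-unshiftCtx⁻ ((zero , _) ∷ Ξ) p = there (∈-unshiftCtx⁻ Ξ p)
∈-unshiftCtx⁻ ((suc _ , _) ∷ Ξ) (here refl) = here refl
∈-unshiftCtx⁻ ((suc _ , _) ∷ Ξ) (there p) = there (∈-unshiftCtx⁻ Ξ p)

∈-unshiftCtx⁺ : ∀ {z C} Ξ → (suc z , C) ∈ Ξ → (z , C) ∈ unshiftCtx Ξ
∈-unshiftCtx⁺ ((zero , _) ∷ Ξ) (there p) = ∈-unshiftCtx⁺ Ξ p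
∈-unshiftCtx⁺ ((suc _ , _) ∷ Ξ) (here refl) = here refl
∈-unshiftCtx⁺ ((suc _ , _) ∷ Ξ) (there p) = there (∈-unshiftCtx⁺ Ξ p)

-- The entries of Ξ at 0 are types of the bound variable, hence follow from 0 : A alone;
-- its other entries type shifted terms, whose typings need no entry at 0.
unsubst-→I : ∀ {Θ σ P A B} → Unsubst ((0 , A) ∷ shiftCtx Θ) (exts σ) P B → Unsubst Θ σ (ƛ P) (A ⇒ B)
unsubst-→I {Θ} {σ} {P} {A} (Ξ , d , h) = unshiftCtx Ξ , →I (⊢-cast (subst-id P) (⊢-subst d h-var)) , h-σ
  where
  h-var : TypedSubst Ξ ((0 , A) ∷ shiftCtx (unshiftCtx Ξ)) var
  h-var {zero} p = ⊢-var-transfer (h p) λ { (here refl) → here refl ; (there q) → ⊥-elim (0∉shiftCtx Θ q) }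
  h-var {suc z} p = Ax (there (∈-shiftCtx⁺ (unshiftCtx Ξ) (∈-unshiftCtx⁺ Ξ p)))
  h-σ : TypedSubst (unshiftCtx Ξ) Θ σ
  h-σ {z} p = ⊢-rename⁻¹ (σ z) (h (∈-unshiftCtx⁻ Ξ p)) λ { (here ()) ; (there q) → ∈-shiftCtx⁻ Θ q }

⊢-subst⁻¹ : ∀ {Θ σ A} P → Θ ⊢ subst σ P ∶ A → Unsubst Θ σ P A
⊢-subst⁻¹ {A = A} (var z) d = (z , A) ∷ [] , Ax (here refl) , λ { (here refl) → d }
⊢-subst⁻¹ (P · Q) (→E d₁ d₂) = unsubst-→E (⊢-subst⁻¹ P d₁) (⊢-subst⁻¹ Q d₂)
⊢-subst⁻¹ (P · Q) (∩I d₁ d₂) = unsubst-∩I (⊢-subst⁻¹ (P · Q) d₁) (⊢-subst⁻¹ (P · Q) d₂)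
⊢-subst⁻¹ (P · Q) (∩E₁ d) = unsubst-∩E₁ (⊢-subst⁻¹ (P · Q) d)
⊢-subst⁻¹ (P · Q) (∩E₂ d) = unsubst-∩E₂ (⊢-subst⁻¹ (P · Q) d)
⊢-subst⁻¹ (ƛ P) (→I d) = unsubst-→I (⊢-subst⁻¹ P d)
⊢-subst⁻¹ (ƛ P) (∩I d₁ d₂) = unsubst-∩I (⊢-subst⁻¹ (ƛ P) d₁) (⊢-subst⁻¹ (ƛ P) d₂)
⊢-subst⁻¹ (ƛ P) (∩E₁ d) = unsubst-∩E₁ (⊢-subst⁻¹ (ƛ P) d)
⊢-subst⁻¹ (ƛ P) (∩E₂ d) = unsubst-∩E₂ (⊢-subst⁻¹ (ƛ P) d)

typesAt0 : Ctx → List Type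
typesAt0 [] = []
typesAt0 ((zero , C) ∷ Ξ) = C ∷ typesAt0 Ξ
typesAt0 ((suc _ , _) ∷ Ξ) = typesAt0 Ξ

⊢-typesAt0-intro : ∀ {Θ Q B} Ξ → TypedSubst Ξ Θ (subst-zero Q) → Θ ⊢ Q ∶ B → Θ ⊢ Q ∶ foldr _∩_ B (typesAt0 Ξ)
⊢-typesAt0-intro [] h dQ = dQ
⊢-typesAt0-intro ((zero , C) ∷ Ξ) h dQ = ∩I (h (here refl)) (⊢-typesAt0-intro Ξ (λ p → h (there p)) dQ)
⊢-typesAt0-intro ((suc _ , _) ∷ Ξ) h dQ = ⊢-typesAt0-intro Ξ (λ p → h (there p)) dQ

⊢-typesAt0-elim : ∀ {Θ M B C} Ξ → (0 , C) ∈ Ξ → Θ ⊢ M ∶ foldr _∩_ B (typesAt0 Ξ) → Θ ⊢ M ∶ C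
⊢-typesAt0-elim ((zero , _) ∷ Ξ) (here refl) d = ∩E₁ d
⊢-typesAt0-elim ((zero , _) ∷ Ξ) (there p) d = ⊢-typesAt0-elim Ξ p (∩E₂ d)
⊢-typesAt0-elim ((suc _ , _) ∷ Ξ) (there p) d = ⊢-typesAt0-elim Ξ p d

-- The argument is given the intersection of the types at which P [ Q ] uses it, together with
-- B, which is needed when P does not use its variable at all.
⊢-expand : ∀ {Θ P Q B C} → Θ ⊢ P [ Q ] ∶ C → Θ ⊢ Q ∶ B → Θ ⊢ (ƛ P) · Q ∶ C
⊢-expand {Θ} {P} {Q} {B} d dQ with ⊢-subst⁻¹ P d
... | Ξ , dP , h = →E (→I (⊢-cast (subst-id P) (⊢-subst dP h-var))) (⊢-typesAt0-intro Ξ h dQ)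
  where
  h-var : TypedSubst Ξ ((0 , foldr _∩_ B (typesAt0 Ξ)) ∷ shiftCtx Θ) var
  h-var {zero} p = ⊢-typesAt0-elim Ξ p (Ax (here refl))
  h-var {suc z} p = ⊢-rename (h p) Renaming-suc

⊢-·-congˡ : ∀ {Θ R R' N} → (∀ {C} → Θ ⊢ R ∶ C → Θ ⊢ R' ∶ C) → ∀ {C} → Θ ⊢ R · N ∶ C → Θ ⊢ R' · N ∶ C
⊢-·-congˡ h (→E d₁ d₂) = →E (h d₁) d₂
⊢-·-congˡ h (∩I d₁ d₂) = ∩I (⊢-·-congˡ h d₁) (⊢-·-congˡ h d₂)
⊢-·-congˡ h (∩E₁ d) = ∩E₁ (⊢-·-congˡ h d)
⊢-·-congˡ h (∩E₂ d) = ∩E₂ (⊢-·-congˡ h d)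

⊢-·*-congˡ : ∀ {Θ R R'} Ns → (∀ {C} → Θ ⊢ R ∶ C → Θ ⊢ R' ∶ C) → ∀ {C} → Θ ⊢ R ·* Ns ∶ C → Θ ⊢ R' ·* Ns ∶ C
⊢-·*-congˡ [] h = h
⊢-·*-congˡ (N ∷ Ns) h = ⊢-·*-congˡ Ns (⊢-·-congˡ h)

soundness : ∀ {Γ Θ σ M A} → Γ ⊢s M ∶ A → TypedSubst Γ Θ σ → Θ ⊢ subst σ M ∶ A
soundness (Ax m) h = h m
soundness (R→ d) h = →I (soundness d (TypedSubst-exts h))
soundness (R∩ d₁ d₂) h = ∩I (soundness d₁ h) (soundness d₂ h)
soundness {σ = σ} (Beta {M = P} {N = Q} {Ns = Ns} d₁ d₂) h =
  ⊢-cast (sym (subst-·* σ ((ƛ P) · Q) Ns))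
    (⊢-·*-congˡ (map (subst σ) Ns) (λ d → ⊢-expand d (soundness d₂ h))
      (⊢-cast (trans (subst-·* σ (P [ Q ]) Ns) (cong (_·* map (subst σ) Ns) (subst-[] σ P Q))) (soundness d₁ h)))
soundness {Θ = Θ} {σ} (L∩ {Γ = Δ'} {x = x} {A₁ = A₁} {A₂} d eq) h = soundness d h'
  where
  h' : TypedSubst ((x , A₁) ∷ (x , A₂) ∷ Δ') Θ σ
  h' (here refl) = ∩E₁ (h (≋-head eq))
  h' (there (here refl)) = ∩E₂ (h (≋-head eq))
  h' (there (there p)) = h (≋-tail eq p)
soundness {σ = σ} (L→ {x = x} {y} {N} {Ns} dN dy y∉Ns y∉Δ' eq) h =
  ⊢-cast (trans (subst-update-·* σ y xN Ns y∉Ns) (sym (subst-·* σ (var x · N) Ns)))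
    (soundness dy (TypedSubst-update (λ p → h (≋-tail eq p)) y∉Δ' (→E (h (≋-head eq)) (soundness dN λ p → h (≋-tail eq p)))))
  where
  xN = σ x · subst σ N

completeness : ∀ {Θ Γ M A} → Θ ⊢ M ∶ A → (∀ {z C} → (z , C) ∈ Θ → Γ ⊢s var z ∶ C) → Γ ⊢s M ∶ A
completeness (Ax m) h = h m
completeness {Γ = Γ} (→I {A = A} d) h =
  R→ (completeness d (binder-elim (λ z C → (0 , A) ∷ shiftCtx Γ ⊢s var z ∶ C) (Ax (here refl))
                                   λ p → ⊢s-rename (h p) Renaming-suc))
completeness (→E d₁ d₂) h = ⊢s-→E (completeness d₁ h) (completeness d₂ h)
completeness (∩I d₁ d₂) h = R∩ (completeness d₁ h) (completeness d₂ h)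
completeness (∩E₁ d) h = ⊢s-∩E₁ (completeness d h)
completeness (∩E₂ d) h = ⊢s-∩E₂ (completeness d h)

-- The context Γ_∩

data Conjunct (C : Type) : Type → Set where
  same : Conjunct C C
  left : ∀ {C₁ C₂} → Conjunct C C₁ → Conjunct C (C₁ ∩ C₂)
  right : ∀ {C₁ C₂} → Conjunct C C₂ → Conjunct C (C₁ ∩ C₂)

Conjunct-trans : ∀ {A B C} → Conjunct A B → Conjunct B C → Conjunct A C
Conjunct-trans c same = c
Conjunct-trans c (left c') = left (Conjunct-trans c c')
Conjunct-trans c (right c') = right (Conjunct-trans c c')

⊢-conjunct : ∀ {Θ M C C'} → Conjunct C C' → Θ ⊢ M ∶ C' → Θ ⊢ M ∶ C
⊢-conjunct same d = d
⊢-conjunct (left c) d = ⊢-conjunct c (∩E₁ d)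
⊢-conjunct (right c) d = ⊢-conjunct c (∩E₂ d)

insertCap-new : ∀ x A Δ → Σ Type λ C' → ((x , C') ∈ insertCap (x , A) Δ) × Conjunct A C'
insertCap-new x A [] = A , here refl , same
insertCap-new x A ((y , C) ∷ Δ) with x ≟ y
... | yes x≡y = A ∩ C , here (cong (_, A ∩ C) x≡y) , left same
... | no _ = let C' , m , c = insertCap-new x A Δ in C' , there m , c

insertCap-old : ∀ x A Δ {z C} → (z , C) ∈ Δ → Σ Type λ C' → ((z , C') ∈ insertCap (x , A) Δ) × Conjunct C C'
insertCap-old x A ((y , C₀) ∷ Δ) p with x ≟ y
insertCap-old x A ((y , C₀) ∷ Δ) (here refl) | yes _ = A ∩ C₀ , here refl , right same
insertCap-old x A ((y , C₀) ∷ Δ) {C = C} (there p) | yes _ = C , there p , same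
insertCap-old x A ((y , C₀) ∷ Δ) (here refl) | no _ = C₀ , here refl , same
insertCap-old x A ((y , C₀) ∷ Δ) (there p) | no _ = let C' , m , c = insertCap-old x A Δ p in C' , there m , c

insertCap⁻ : ∀ x A Δ {z C} → (z , C) ∈ insertCap (x , A) Δ →
             ((z , C) ≡ (x , A)) ⊎ ((z , C) ∈ Δ) ⊎ (Σ Type λ C' → (z ≡ x) × (C ≡ A ∩ C') × ((z , C') ∈ Δ))
insertCap⁻ x A [] (here refl) = inj₁ refl
insertCap⁻ x A ((y , C₀) ∷ Δ) p with x ≟ y
insertCap⁻ x A ((y , C₀) ∷ Δ) (here refl) | yes x≡y = inj₂ (inj₂ (C₀ , sym x≡y , refl , here refl))
insertCap⁻ x A ((y , C₀) ∷ Δ) (there p) | yes _ = inj₂ (inj₁ (there p))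
insertCap⁻ x A ((y , C₀) ∷ Δ) (here refl) | no _ = inj₂ (inj₁ (here refl))
insertCap⁻ x A ((y , C₀) ∷ Δ) (there p) | no _ with insertCap⁻ x A Δ p
... | inj₁ e = inj₁ e
... | inj₂ (inj₁ q) = inj₂ (inj₁ (there q))
... | inj₂ (inj₂ (C' , e₁ , e₂ , q)) = inj₂ (inj₂ (C' , e₁ , e₂ , there q))

foldCap⁺ : ∀ L {z C} → (z , C) ∈ L → Σ Type λ C' → ((z , C') ∈ foldr insertCap [] L) × Conjunct C C'
foldCap⁺ ((x , A) ∷ L) (here refl) = insertCap-new x A (foldr insertCap [] L)
foldCap⁺ ((x , A) ∷ L) (there p) =
  let C' , m , c = foldCap⁺ L p
      C'' , m' , c' = insertCap-old x A (foldr insertCap [] L) m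
  in C'' , m' , Conjunct-trans c c'

foldCap⁻ : ∀ {Γ} L {z C} → (z , C) ∈ foldr insertCap [] L → L ⊆ Γ → Γ ⊢s var z ∶ C
foldCap⁻ ((x , A) ∷ L) m L⊆Γ with insertCap⁻ x A (foldr insertCap [] L) m
... | inj₁ e = Ax (L⊆Γ (here e))
... | inj₂ (inj₁ p) = foldCap⁻ L p (λ q → L⊆Γ (there q))
... | inj₂ (inj₂ (C' , refl , refl , p)) = R∩ (Ax (L⊆Γ (here refl))) (foldCap⁻ L p (λ q → L⊆Γ (there q)))

capCtx-var : ∀ Γ {z C} → (z , C) ∈ Γ → capCtx Γ ⊢ var z ∶ C
capCtx-var Γ m = let C' , m' , c = foldCap⁺ (deduplicate _≟p_ Γ) (∈-deduplicate⁺ _≟p_ m) in ⊢-conjunct c (Ax m')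

capCtx-var⁻ : ∀ Γ {z C} → (z , C) ∈ capCtx Γ → Γ ⊢s var z ∶ C
capCtx-var⁻ Γ m = foldCap⁻ (deduplicate _≟p_ Γ) m (∈-deduplicate⁻ _≟p_ Γ)

theorem3 : (Γ : Ctx) (M : Term) (A : Type) →
    ((Γ ⊢s M ∶ A) → (capCtx Γ ⊢ M ∶ A)) × ((capCtx Γ ⊢ M ∶ A) → (Γ ⊢s M ∶ A))
theorem3 Γ M A =
  (λ d → ⊢-cast (subst-id M) (soundness d (capCtx-var Γ))) ,
  (λ d → completeness d (capCtx-var⁻ Γ))
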